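{- Let $p\ge1$ and $r_1\le\cdots\le r_p$ be nonnegative integers, $\mathbf{r}_p=(r_1,\ldots,r_p)$. For all integers $n\ge0$ and $0\le k\le n+|\mathbf{r}_{p-1}|$, $${n+|\mathbf{r}_p|\brace k+r_p}_{\mathbf{r}_p}=\sum_{j=0}^{|\mathbf{r}_{p-1}|}{n+j+r_p\brace k+r_p}_{r_p}\,a_j(\mathbf{r}_{p-1}).$$
   Context: $|\mathbf{r}_p|=r_1+\cdots+r_p$, $|\mathbf{r}_{p-1}|=r_1+\cdots+r_{p-1}$. With $R_1=\{1,\ldots,r_1\}$, $R_2=\{r_1+1,\ldots,r_1+r_2\}$, ..., ${N\brace k}_{\mathbf{r}_p}$ is the number of partitions of $\{1,\ldots,N\}$ into $k$ nonempty blocks such that for each $i$ the elements of $R_i$ lie in distinct blocks; ${N\brace k}_{r}$ (case of a single set $\{1,\ldots,r\}$) is Broder's $r$-Stirling number of the second kind. With $\genfrac{[}{]}{0pt}{}{n}{k}$ the unsigned Stirling numbers of the first kind, $a_j(\mathbf{r}_{p-1})=(-1)^{|\mathbf{r}_{p-1}|-j}\sum_{j_1+\cdots+j_{p-1}=j}\genfrac{[}{]}{0pt}{}{r_1}{j_1}\cdots\genfrac{[}{]}{0pt}{}{r_{p-1}}{j_{p-1}}$, i.e. $\sum_j a_j(\mathbf{r}_{p-1})u^j=u^{\underline{r_1}}\cdots u^{\underline{r_{p-1}}}$. -}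

module Defs where

open import Data.Nat using (ℕ; zero; suc; _+_; _*_; _∸_; _≡ᵇ_; _≤ᵇ_)
open import Data.Bool using (Bool; true; false; _∧_; not; if_then_else_)
open import Data.List using (List; []; _∷_; map; concatMap; upTo; take; drop)
open import Data.Bool.ListAction using (any)
open import Data.Nat.ListAction using (sum)
open import Data.Integer as ℤ using (ℤ; +_)

-- Set partitions of {1,…,N} into k nonempty blocks, encoded as
-- restricted growth strings (RGS): a word w = w₁ … w_N over {0,…,k-1}
-- with w₁ = 0, w_{i+1} ≤ 1 + max(w₁,…,w_i), using all k letters.
-- Position i of the word is element i of {1,…,N}; w_i is its block label
-- (blocks labelled in order of their least element).

words : ℕ → ℕ → List (List ℕ)
words zero    k = [] ∷ []
words (suc N) k = concatMap (λ w → map (λ x → x ∷ w) (upTo k)) (words N k)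

-- isRGS m k w : w is a restricted growth string continuing from a prefix
-- that already used the m labels 0,…,m-1, and it uses exactly k labels in total
isRGS : ℕ → ℕ → List ℕ → Bool
isRGS m k []       = m ≡ᵇ k
isRGS m k (x ∷ xs) = (x ≤ᵇ m) ∧ isRGS (if x ≡ᵇ m then suc m else m) k xs

allDistinct : List ℕ → Bool
allDistinct []       = true
allDistinct (x ∷ xs) = not (any (x ≡ᵇ_) xs) ∧ allDistinct xs

-- For sizes rs = (r₁,…,r_m): R₁ = first r₁ elements, R₂ = next r₂, …;
-- the elements of each Rᵢ must lie in distinct blocks.
distinctOn : List ℕ → List ℕ → Bool
distinctOn []       w = true
distinctOn (r ∷ rs) w = allDistinct (take r w) ∧ distinctOn rs (drop r w)

countTrue : {A : Set} → (A → Bool) → List A → ℕ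
countTrue P []       = 0
countTrue P (x ∷ xs) = (if P x then 1 else 0) + countTrue P xs

RStirling2 : ℕ → ℕ → List ℕ → ℕ
RStirling2 N k rs = countTrue (λ w → isRGS 0 k w ∧ distinctOn rs w) (words N k)

-- Broder's r-Stirling number of the second kind { N \brace k }_r
-- (single distinguished set {1,…,r})
rStirling2 : ℕ → ℕ → ℕ → ℕ
rStirling2 N k r = RStirling2 N k (r ∷ [])

stirling1 : ℕ → ℕ → ℕ
stirling1 zero    zero    = 1
stirling1 zero    (suc k) = 0
stirling1 (suc n) zero    = 0
stirling1 (suc n) (suc k) = n * stirling1 n (suc k) + stirling1 n k

convStirling1 : List ℕ → ℕ → ℕ
convStirling1 []       j = if j ≡ᵇ 0 then 1 else 0
convStirling1 (r ∷ rs) j =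
  sum (map (λ i → stirling1 r i * convStirling1 rs (j ∸ i)) (upTo (suc j)))

-- a_j(rs) = (-1)^{|rs| - j} Σ_{j₁+⋯+j_m = j} [r₁, j₁] ⋯ [r_m, j_m]
-- (for j > |rs| the sum is 0, so truncated subtraction is harmless)
aCoef : List ℕ → ℕ → ℤ
aCoef rs j = ((ℤ.- (+ 1)) ℤ.^ (sum rs ∸ j)) ℤ.* (+ convStirling1 rs j)

sumℤ : ℕ → (ℕ → ℤ) → ℤ
sumℤ zero    f = f 0
sumℤ (suc m) f = sumℤ m f ℤ.+ f (suc m)

{-# OPTIONS --safe #-}
-- Read a restricted growth string from left to right.  The number of ways to complete a prefix that
-- has opened m blocks is a sequence v(m), and one more element that must avoid t given blocks acts
-- on it by (m − t)·v(m) + v(m + 1).  These operators commute, so a set R_i of r_i elements in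
-- distinct blocks acts as the falling factorial T(T − 1)⋯(T − r_i + 1) of the operator T of an
-- unconstrained element, and an unconstrained element is a set of size 1.  The first p − 1 sets
-- therefore act as ∏ T^(r_i falling) = Σ_j a_j(r_{p−1}) T^j, and T^j applied to the count for the
-- last set and n free elements is the count for that set and n + j free elements, i.e. an
-- r_p-Stirling number.
module Submission where

open import Defs
open import Data.Nat using (ℕ; _+_; _≤_)
open import Data.List using (List; []; _∷_; _++_)
open import Data.Nat.ListAction using (sum)
open import Data.List.Relation.Unary.Linked using (Linked)
open import Data.Integer as ℤ using (ℤ; +_)
open import Relation.Binary.PropositionalEquality using (_≡_)

import Data.Integer.Properties as ℤₚ
open import Algebra.Properties.CommutativeSemigroup ℤₚ.+-commutativeSemigroup
  using () renaming (interchange to +-interchange)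
open import Algebra.Properties.CommutativeSemigroup ℤₚ.*-commutativeSemigroup
  using () renaming (interchange to *-interchange)
open import Data.Bool using (Bool; true; false; _∧_; _∨_; not; if_then_else_)
open import Data.Bool.ListAction using (any)
import Data.Bool.Properties as Boolₚ
open import Data.Empty using (⊥-elim)
open import Data.Integer.Tactic.RingSolver using (solve-∀)
open import Data.List using (map; concatMap; upTo; _∷ʳ_; length; take; drop; replicate)
import Data.List.Properties as Listₚ
open import Data.List.Relation.Unary.All as All using (All; []; _∷_)
open import Data.List.Relation.Unary.All.Properties using (∷ʳ⁺)
open import Data.Nat using (zero; suc; _*_; _∸_; _<_; z≤n; s≤s; _≡ᵇ_; _≤ᵇ_)
open import Data.Nat.ListAction.Properties using (sum-++)
import Data.Nat.Properties as ℕₚ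
import Data.Nat.Tactic.RingSolver as ℕ-Solver
open import Data.Product using (_×_; _,_)
open import Data.Sum using (inj₁; inj₂)
open import Relation.Binary.PropositionalEquality
  using (refl; sym; trans; cong; cong₂; _≗_; _≢_; module ≡-Reasoning)
open import Relation.Nullary using (yes; no)
open import Relation.Nullary.Reflects using (Reflects; ofʸ; ofⁿ; fromEquivalence)

-- Finite sums

sumℤ< : ℕ → (ℕ → ℤ) → ℤ
sumℤ< zero    f = + 0
sumℤ< (suc K) f = sumℤ< K f ℤ.+ f K

sumℤ<-cong : ∀ K {f g : ℕ → ℤ} → (∀ x → x < K → f x ≡ g x) → sumℤ< K f ≡ sumℤ< K g
sumℤ<-cong zero    f≡g = refl
sumℤ<-cong (suc K) f≡g =
  cong₂ ℤ._+_ (sumℤ<-cong K (λ x x<K → f≡g x (ℕₚ.m<n⇒m<1+n x<K))) (f≡g K (ℕₚ.n<1+n K))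

sumℤ<-distrib-+ : ∀ K (f g : ℕ → ℤ) →
  sumℤ< K (λ x → f x ℤ.+ g x) ≡ sumℤ< K f ℤ.+ sumℤ< K g
sumℤ<-distrib-+ zero    f g = refl
sumℤ<-distrib-+ (suc K) f g =
  trans (cong (ℤ._+ (f K ℤ.+ g K)) (sumℤ<-distrib-+ K f g))
        (+-interchange (sumℤ< K f) (sumℤ< K g) (f K) (g K))

*-distribˡ-sumℤ< : ∀ K c (f : ℕ → ℤ) → c ℤ.* sumℤ< K f ≡ sumℤ< K (λ x → c ℤ.* f x)
*-distribˡ-sumℤ< zero    c f = ℤₚ.*-zeroʳ c
*-distribˡ-sumℤ< (suc K) c f =
  trans (ℤₚ.*-distribˡ-+ c (sumℤ< K f) (f K)) (cong (ℤ._+ c ℤ.* f K) (*-distribˡ-sumℤ< K c f))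

*-distribʳ-sumℤ< : ∀ K c (f : ℕ → ℤ) → sumℤ< K f ℤ.* c ≡ sumℤ< K (λ x → f x ℤ.* c)
*-distribʳ-sumℤ< zero    c f = ℤₚ.*-zeroˡ c
*-distribʳ-sumℤ< (suc K) c f =
  trans (ℤₚ.*-distribʳ-+ c (sumℤ< K f) (f K)) (cong (ℤ._+ f K ℤ.* c) (*-distribʳ-sumℤ< K c f))

sumℤ<-const : ∀ K a → sumℤ< K (λ _ → a) ≡ + K ℤ.* a
sumℤ<-const zero    a = sym (ℤₚ.*-zeroˡ a)
sumℤ<-const (suc K) a = begin
  sumℤ< K (λ _ → a) ℤ.+ a  ≡⟨ cong (ℤ._+ a) (sumℤ<-const K a) ⟩
  + K ℤ.* a ℤ.+ a          ≡⟨ distrib (+ K) a ⟩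
  (+ 1 ℤ.+ + K) ℤ.* a      ≡⟨ cong (ℤ._* a) (sym (ℤₚ.pos-+ 1 K)) ⟩
  + suc K ℤ.* a            ∎
  where
  open ≡-Reasoning
  distrib : ∀ k a → k ℤ.* a ℤ.+ a ≡ (+ 1 ℤ.+ k) ℤ.* a
  distrib = solve-∀

sumℤ<-unfoldˡ : ∀ K (f : ℕ → ℤ) → sumℤ< (suc K) f ≡ f 0 ℤ.+ sumℤ< K (λ x → f (suc x))
sumℤ<-unfoldˡ zero    f = trans (ℤₚ.+-identityˡ (f 0)) (sym (ℤₚ.+-identityʳ (f 0)))
sumℤ<-unfoldˡ (suc K) f =
  trans (cong (ℤ._+ f (suc K)) (sumℤ<-unfoldˡ K f))
        (ℤₚ.+-assoc (f 0) (sumℤ< K (λ x → f (suc x))) (f (suc K)))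

sumℤ<-extend : ∀ d K (f : ℕ → ℤ) → d ≤ K → (∀ x → d ≤ x → x < K → f x ≡ + 0) →
  sumℤ< K f ≡ sumℤ< d f
sumℤ<-extend d zero    f z≤n     f≡0 = refl
sumℤ<-extend d (suc K) f d≤1+K f≡0 with ℕₚ.m≤n⇒m<n∨m≡n d≤1+K
... | inj₂ refl     = refl
... | inj₁ (s≤s d≤K) =
  trans (cong₂ ℤ._+_ (sumℤ<-extend d K f d≤K (λ x d≤x x<K → f≡0 x d≤x (ℕₚ.m<n⇒m<1+n x<K)))
                     (f≡0 K d≤K (ℕₚ.n<1+n K)))
        (ℤₚ.+-identityʳ _)

sumℤ<-point : ∀ {s K} (f : ℕ → ℤ) → s < K → (∀ x → x ≢ s → f x ≡ + 0) → sumℤ< K f ≡ f s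
sumℤ<-point {s} {suc K} f s<1+K f≡0 with ℕₚ.m≤n⇒m<n∨m≡n (ℕₚ.≤-pred s<1+K)
... | inj₁ s<K = trans (cong₂ ℤ._+_ (sumℤ<-point f s<K f≡0) (f≡0 K (λ K≡s → ℕₚ.<⇒≢ s<K (sym K≡s))))
                       (ℤₚ.+-identityʳ (f s))
... | inj₂ refl = trans (cong (ℤ._+ f s) (sumℤ<-extend 0 s f z≤n (λ x _ x<s → f≡0 x (ℕₚ.<⇒≢ x<s))))
                        (ℤₚ.+-identityˡ (f s))

sumℤ<-triangle : ∀ N (h : ℕ → ℕ → ℤ) →
  sumℤ< N (λ i → sumℤ< (N ∸ i) (h i)) ≡ sumℤ< N (λ J → sumℤ< (suc J) (λ i → h i (J ∸ i)))
sumℤ<-triangle zero    h = refl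
sumℤ<-triangle (suc N) h = begin
  sumℤ< N (λ i → sumℤ< (suc N ∸ i) (h i)) ℤ.+ sumℤ< (suc N ∸ N) (h N)
    ≡⟨ cong₂ ℤ._+_ (sumℤ<-cong N (λ i i<N → row-suc i (ℕₚ.<⇒≤ i<N))) (row-suc N ℕₚ.≤-refl) ⟩
  sumℤ< N (λ i → sumℤ< (N ∸ i) (h i) ℤ.+ diagonal i) ℤ.+ (sumℤ< (N ∸ N) (h N) ℤ.+ diagonal N)
    ≡⟨ cong₂ ℤ._+_ (sumℤ<-distrib-+ N (λ i → sumℤ< (N ∸ i) (h i)) diagonal)
                   (cong (λ e → sumℤ< e (h N) ℤ.+ diagonal N) (ℕₚ.n∸n≡0 N)) ⟩
  (sumℤ< N (λ i → sumℤ< (N ∸ i) (h i)) ℤ.+ sumℤ< N diagonal) ℤ.+ (+ 0 ℤ.+ diagonal N)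
    ≡⟨ cong₂ (λ a b → (a ℤ.+ sumℤ< N diagonal) ℤ.+ b) (sumℤ<-triangle N h) (ℤₚ.+-identityˡ (diagonal N)) ⟩
  (sumℤ< N antidiagonal ℤ.+ sumℤ< N diagonal) ℤ.+ diagonal N
    ≡⟨ ℤₚ.+-assoc (sumℤ< N antidiagonal) (sumℤ< N diagonal) (diagonal N) ⟩
  sumℤ< N antidiagonal ℤ.+ sumℤ< (suc N) diagonal ∎
  where
  open ≡-Reasoning
  diagonal antidiagonal : ℕ → ℤ
  diagonal i = h i (N ∸ i)
  antidiagonal J = sumℤ< (suc J) (λ i → h i (J ∸ i))
  row-suc : ∀ i → i ≤ N → sumℤ< (suc N ∸ i) (h i) ≡ sumℤ< (N ∸ i) (h i) ℤ.+ diagonal i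
  row-suc i i≤N = cong (λ e → sumℤ< e (h i)) (ℕₚ.+-∸-assoc 1 i≤N)

pos-sum-map-upTo : ∀ K (g : ℕ → ℕ) → + sum (map g (upTo K)) ≡ sumℤ< K (λ x → + g x)
pos-sum-map-upTo zero    g = refl
pos-sum-map-upTo (suc K) g = begin
  + sum (map g (upTo (suc K)))              ≡⟨ cong (λ xs → + sum (map g xs)) (sym (Listₚ.upTo-∷ʳ K)) ⟩
  + sum (map g (upTo K ∷ʳ K))               ≡⟨ cong (λ xs → + sum xs) (Listₚ.map-++ g (upTo K) (K ∷ [])) ⟩
  + sum (map g (upTo K) ++ g K ∷ [])        ≡⟨ cong +_ (sum-++ (map g (upTo K)) (g K ∷ [])) ⟩
  + (sum (map g (upTo K)) + (g K + 0))      ≡⟨ ℤₚ.pos-+ (sum (map g (upTo K))) (g K + 0) ⟩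
  + sum (map g (upTo K)) ℤ.+ + (g K + 0)    ≡⟨ cong₂ ℤ._+_ (pos-sum-map-upTo K g) (cong +_ (ℕₚ.+-identityʳ (g K))) ⟩
  sumℤ< K (λ x → + g x) ℤ.+ + g K           ∎
  where open ≡-Reasoning

sumℤ≡sumℤ< : ∀ d (f : ℕ → ℤ) → sumℤ d f ≡ sumℤ< (suc d) f
sumℤ≡sumℤ< zero    f = sym (ℤₚ.+-identityˡ (f 0))
sumℤ≡sumℤ< (suc d) f = cong (ℤ._+ f (suc d)) (sumℤ≡sumℤ< d f)

i≡0⇒i*j≡0 : ∀ {i} j → i ≡ + 0 → i ℤ.* j ≡ + 0
i≡0⇒i*j≡0 j refl = ℤₚ.*-zeroˡ j

j≡0⇒i*j≡0 : ∀ i {j} → j ≡ + 0 → i ℤ.* j ≡ + 0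
j≡0⇒i*j≡0 i refl = ℤₚ.*-zeroʳ i

-- Placement operators

Seq : Set
Seq = ℕ → ℤ

-- A new element, when m blocks are open and t of them are forbidden to it, joins one of the other
-- m − t blocks or opens block m + 1.
place : ℕ → Seq → Seq
place t v m = (+ m ℤ.- + t) ℤ.* v m ℤ.+ v (suc m)

placeDistinct : ℕ → ℕ → Seq → Seq
placeDistinct t zero    v = v
placeDistinct t (suc r) v = place t (placeDistinct (suc t) r v)

placeSegments : List ℕ → Seq → Seq
placeSegments []       v = v
placeSegments (r ∷ rs) v = placeDistinct 0 r (placeSegments rs v)

placeFree : ℕ → Seq → Seq
placeFree zero    v = v
placeFree (suc n) v = place 0 (placeFree n v)

place-cong : ∀ t {v w : Seq} → v ≗ w → place t v ≗ place t w
place-cong t v≗w m = cong₂ (λ a b → (+ m ℤ.- + t) ℤ.* a ℤ.+ b) (v≗w m) (v≗w (suc m))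

placeDistinct-cong : ∀ t r {v w : Seq} → v ≗ w → placeDistinct t r v ≗ placeDistinct t r w
placeDistinct-cong t zero    v≗w = v≗w
placeDistinct-cong t (suc r) v≗w = place-cong t (placeDistinct-cong (suc t) r v≗w)

place-comm : ∀ s t v → place s (place t v) ≗ place t (place s v)
place-comm s t v m = begin
  E (+ suc m) (+ s) (+ t)     ≡⟨ cong (λ y → E y (+ s) (+ t)) (ℤₚ.pos-+ 1 m) ⟩
  E (+ 1 ℤ.+ + m) (+ s) (+ t) ≡⟨ symmetric (+ m) (+ s) (+ t) (v m) (v (suc m)) (v (suc (suc m))) ⟩
  E (+ 1 ℤ.+ + m) (+ t) (+ s) ≡⟨ cong (λ y → E y (+ t) (+ s)) (sym (ℤₚ.pos-+ 1 m)) ⟩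
  E (+ suc m) (+ t) (+ s)     ∎
  where
  open ≡-Reasoning
  E : ℤ → ℤ → ℤ → ℤ
  E y s t = (+ m ℤ.- s) ℤ.* ((+ m ℤ.- t) ℤ.* v m ℤ.+ v (suc m)) ℤ.+ ((y ℤ.- t) ℤ.* v (suc m) ℤ.+ v (suc (suc m)))
  symmetric : ∀ x s t a b c →
    (x ℤ.- s) ℤ.* ((x ℤ.- t) ℤ.* a ℤ.+ b) ℤ.+ ((+ 1 ℤ.+ x ℤ.- t) ℤ.* b ℤ.+ c)
    ≡ (x ℤ.- t) ℤ.* ((x ℤ.- s) ℤ.* a ℤ.+ b) ℤ.+ ((+ 1 ℤ.+ x ℤ.- s) ℤ.* b ℤ.+ c)
  symmetric = solve-∀

place-placeDistinct : ∀ s t r v → place s (placeDistinct t r v) ≗ placeDistinct t r (place s v)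
place-placeDistinct s t zero    v m = refl
place-placeDistinct s t (suc r) v m =
  trans (place-comm s t (placeDistinct (suc t) r v) m) (place-cong t (place-placeDistinct s (suc t) r v) m)

placeDistinct-suc : ∀ t r v → placeDistinct t (suc r) v ≗ place (t + r) (placeDistinct t r v)
placeDistinct-suc t zero    v m = cong (λ t′ → place t′ v m) (sym (ℕₚ.+-identityʳ t))
placeDistinct-suc t (suc r) v m = begin
  place t (placeDistinct (suc t) (suc r) v) m
    ≡⟨ place-cong t (placeDistinct-suc (suc t) r v) m ⟩
  place t (place (suc t + r) (placeDistinct (suc t) r v)) m
    ≡⟨ place-comm t (suc t + r) (placeDistinct (suc t) r v) m ⟩
  place (suc t + r) (placeDistinct t (suc r) v) m
    ≡⟨ cong (λ t′ → place t′ (placeDistinct t (suc r) v) m) (sym (ℕₚ.+-suc t r)) ⟩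
  place (t + suc r) (placeDistinct t (suc r) v) m ∎
  where open ≡-Reasoning

placeFree-placeDistinct : ∀ i t r v → placeFree i (placeDistinct t r v) ≗ placeDistinct t r (placeFree i v)
placeFree-placeDistinct zero    t r v m = refl
placeFree-placeDistinct (suc i) t r v m =
  trans (place-cong 0 (placeFree-placeDistinct i t r v) m) (place-placeDistinct 0 t r (placeFree i v) m)

placeFree-placeSegments : ∀ i rs v → placeFree i (placeSegments rs v) ≗ placeSegments rs (placeFree i v)
placeFree-placeSegments i []       v m = refl
placeFree-placeSegments i (r ∷ rs) v m =
  trans (placeFree-placeDistinct i 0 r (placeSegments rs v) m)
        (placeDistinct-cong 0 r (placeFree-placeSegments i rs v) m)

placeFree-+ : ∀ j n v → placeFree j (placeFree n v) ≡ placeFree (j + n) v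
placeFree-+ zero    n v = refl
placeFree-+ (suc j) n v = cong (place 0) (placeFree-+ j n v)

placeSegments-++ : ∀ rs ys v → placeSegments (rs ++ ys) v ≡ placeSegments rs (placeSegments ys v)
placeSegments-++ []       ys v = refl
placeSegments-++ (r ∷ rs) ys v = cong (placeDistinct 0 r) (placeSegments-++ rs ys v)

place-linear : ∀ t D (c : ℕ → ℤ) (f : ℕ → Seq) m →
  place t (λ m′ → sumℤ< D (λ i → c i ℤ.* f i m′)) m ≡ sumℤ< D (λ i → c i ℤ.* place t (f i) m)
place-linear t zero    c f m = trans (ℤₚ.+-identityʳ _) (ℤₚ.*-zeroʳ (+ m ℤ.- + t))
place-linear t (suc D) c f m =
  trans (distribute (+ m ℤ.- + t) _ _ (c D) (f D m) (f D (suc m)))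
        (cong (ℤ._+ c D ℤ.* place t (f D) m) (place-linear t D c f m))
  where
  distribute : ∀ x a b c p q →
    x ℤ.* (a ℤ.+ c ℤ.* p) ℤ.+ (b ℤ.+ c ℤ.* q) ≡ (x ℤ.* a ℤ.+ b) ℤ.+ c ℤ.* (x ℤ.* p ℤ.+ q)
  distribute = solve-∀

place-via-place0 : ∀ t v m → place t v m ≡ place 0 v m ℤ.- + t ℤ.* v m
place-via-place0 t v m = expand (+ m) (+ t) (v m) (v (suc m))
  where
  expand : ∀ x t a b → (x ℤ.- t) ℤ.* a ℤ.+ b ≡ ((x ℤ.- + 0) ℤ.* a ℤ.+ b) ℤ.- t ℤ.* a
  expand = solve-∀

-- Polynomials in the placement operator of an unconstrained element

applyPoly : (ℕ → ℤ) → ℕ → Seq → Seq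
applyPoly c D v m = sumℤ< D (λ i → c i ℤ.* placeFree i v m)

timesXminus : ℕ → (ℕ → ℤ) → ℕ → ℤ
timesXminus t c zero    = ℤ.- (+ t ℤ.* c 0)
timesXminus t c (suc i) = c i ℤ.- + t ℤ.* c (suc i)

applyPoly-place : ∀ t c D v m → c D ≡ + 0 →
  place t (applyPoly c D v) m ≡ applyPoly (timesXminus t c) (suc D) v m
applyPoly-place t c D v m cD≡0 = begin
  place t (applyPoly c D v) m
    ≡⟨ place-via-place0 t (applyPoly c D v) m ⟩
  place 0 (applyPoly c D v) m ℤ.- + t ℤ.* applyPoly c D v m
    ≡⟨ cong₂ (λ a b → a ℤ.- + t ℤ.* b) (place-linear 0 D c (λ i → placeFree i v) m) lowest-term ⟩
  T₁ ℤ.- + t ℤ.* (c 0 ℤ.* F 0 ℤ.+ T₂)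
    ≡⟨ regroup (+ t) (c 0) (F 0) T₁ T₂ ⟩
  timesXminus t c 0 ℤ.* F 0 ℤ.+ (T₁ ℤ.+ ℤ.- + t ℤ.* T₂)
    ≡⟨ cong (ℤ._+_ (timesXminus t c 0 ℤ.* F 0)) higher-terms ⟩
  timesXminus t c 0 ℤ.* F 0 ℤ.+ sumℤ< D (λ i → timesXminus t c (suc i) ℤ.* F (suc i))
    ≡⟨ sym (sumℤ<-unfoldˡ D (λ i → timesXminus t c i ℤ.* F i)) ⟩
  applyPoly (timesXminus t c) (suc D) v m ∎
  where
  open ≡-Reasoning
  F : ℕ → ℤ
  F i = placeFree i v m
  T₁ T₂ : ℤ
  T₁ = sumℤ< D (λ i → c i ℤ.* F (suc i))
  T₂ = sumℤ< D (λ i → c (suc i) ℤ.* F (suc i))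
  lowest-term : applyPoly c D v m ≡ c 0 ℤ.* F 0 ℤ.+ T₂
  lowest-term = begin
    sumℤ< D (λ i → c i ℤ.* F i)                  ≡⟨ sym (ℤₚ.+-identityʳ _) ⟩
    sumℤ< D (λ i → c i ℤ.* F i) ℤ.+ + 0          ≡⟨ cong (ℤ._+_ (sumℤ< D (λ i → c i ℤ.* F i)))
                                                       (sym (i≡0⇒i*j≡0 (F D) cD≡0)) ⟩
    sumℤ< (suc D) (λ i → c i ℤ.* F i)            ≡⟨ sumℤ<-unfoldˡ D (λ i → c i ℤ.* F i) ⟩
    c 0 ℤ.* F 0 ℤ.+ T₂                           ∎
  higher-terms : T₁ ℤ.+ ℤ.- + t ℤ.* T₂ ≡ sumℤ< D (λ i → timesXminus t c (suc i) ℤ.* F (suc i))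
  higher-terms = begin
    T₁ ℤ.+ ℤ.- + t ℤ.* T₂
      ≡⟨ cong (ℤ._+_ T₁) (*-distribˡ-sumℤ< D (ℤ.- + t) (λ i → c (suc i) ℤ.* F (suc i))) ⟩
    T₁ ℤ.+ sumℤ< D (λ i → ℤ.- + t ℤ.* (c (suc i) ℤ.* F (suc i)))
      ≡⟨ sym (sumℤ<-distrib-+ D _ _) ⟩
    sumℤ< D (λ i → c i ℤ.* F (suc i) ℤ.+ ℤ.- + t ℤ.* (c (suc i) ℤ.* F (suc i)))
      ≡⟨ sumℤ<-cong D (λ i _ → factor (c i) (+ t) (c (suc i)) (F (suc i))) ⟩
    sumℤ< D (λ i → timesXminus t c (suc i) ℤ.* F (suc i)) ∎
    where
    factor : ∀ a t b f → a ℤ.* f ℤ.+ ℤ.- t ℤ.* (b ℤ.* f) ≡ (a ℤ.- t ℤ.* b) ℤ.* f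
    factor = solve-∀
  regroup : ∀ t c₀ f₀ x y → x ℤ.- t ℤ.* (c₀ ℤ.* f₀ ℤ.+ y) ≡ ℤ.- (t ℤ.* c₀) ℤ.* f₀ ℤ.+ (x ℤ.+ ℤ.- t ℤ.* y)
  regroup = solve-∀

-- Stirling numbers of the first kind and the coefficients a_j

stirling1-vanish : ∀ {r i} → r < i → stirling1 r i ≡ 0
stirling1-vanish {zero}  {suc i} _ = refl
stirling1-vanish {suc r} {suc i} (s≤s r<i) =
  trans (cong₂ (λ a b → r * a + b) (stirling1-vanish (ℕₚ.m<n⇒m<1+n r<i)) (stirling1-vanish r<i))
        (cong (_+ 0) (ℕₚ.*-zeroʳ r))

signedStirling1 : ℕ → ℕ → ℤ
signedStirling1 r i = (ℤ.- + 1) ℤ.^ (r ∸ i) ℤ.* + stirling1 r i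

signedStirling1-vanish : ∀ {r i} → r < i → signedStirling1 r i ≡ + 0
signedStirling1-vanish {r} {i} r<i = j≡0⇒i*j≡0 ((ℤ.- + 1) ℤ.^ (r ∸ i)) (cong +_ (stirling1-vanish r<i))

signedStirling1-sign-step : ∀ r i →
  (ℤ.- + 1) ℤ.^ (r ∸ i) ℤ.* + stirling1 r (suc i) ≡ ℤ.- signedStirling1 r (suc i)
signedStirling1-sign-step r i with i ℕₚ.<? r
... | yes i<r = trans (cong (λ e → (ℤ.- + 1) ℤ.^ e ℤ.* + stirling1 r (suc i)) (ℕₚ.+-∸-assoc 1 i<r))
                      (negate ((ℤ.- + 1) ℤ.^ (r ∸ suc i)) (+ stirling1 r (suc i)))
  where
  negate : ∀ q a → (ℤ.- + 1 ℤ.* q) ℤ.* a ≡ ℤ.- (q ℤ.* a)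
  negate = solve-∀
... | no i≮r = trans (j≡0⇒i*j≡0 ((ℤ.- + 1) ℤ.^ (r ∸ i)) (cong +_ (stirling1-vanish r<1+i)))
                     (sym (cong ℤ.-_ (signedStirling1-vanish r<1+i)))
  where
  r<1+i : r < suc i
  r<1+i = s≤s (ℕₚ.≮⇒≥ i≮r)

signedStirling1-recurrence : ∀ r i → signedStirling1 (suc r) i ≡ timesXminus r (signedStirling1 r) i
signedStirling1-recurrence r zero =
  trans (ℤₚ.*-zeroʳ ((ℤ.- + 1) ℤ.^ suc r)) (cong ℤ.-_ (sym (r*s[r,0]≡0 r)))
  where
  r*s[r,0]≡0 : ∀ r → + r ℤ.* signedStirling1 r 0 ≡ + 0
  r*s[r,0]≡0 zero    = ℤₚ.*-zeroˡ (signedStirling1 0 0)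
  r*s[r,0]≡0 (suc r) = j≡0⇒i*j≡0 (+ suc r) (j≡0⇒i*j≡0 ((ℤ.- + 1) ℤ.^ suc r) refl)
signedStirling1-recurrence r (suc i) = begin
  P ℤ.* + (r * A + B)
    ≡⟨ cong (P ℤ.*_) (trans (ℤₚ.pos-+ (r * A) B) (cong (ℤ._+ + B) (ℤₚ.pos-* r A))) ⟩
  P ℤ.* (+ r ℤ.* + A ℤ.+ + B)
    ≡⟨ expand P (+ r) (+ A) (+ B) ⟩
  + r ℤ.* (P ℤ.* + A) ℤ.+ P ℤ.* + B
    ≡⟨ cong (λ z → + r ℤ.* z ℤ.+ P ℤ.* + B) (signedStirling1-sign-step r i) ⟩
  + r ℤ.* ℤ.- signedStirling1 r (suc i) ℤ.+ P ℤ.* + B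
    ≡⟨ regroup (+ r) (signedStirling1 r (suc i)) (P ℤ.* + B) ⟩
  P ℤ.* + B ℤ.- + r ℤ.* signedStirling1 r (suc i) ∎
  where
  open ≡-Reasoning
  P = (ℤ.- + 1) ℤ.^ (r ∸ i)
  A = stirling1 r (suc i)
  B = stirling1 r i
  expand : ∀ p r a b → p ℤ.* (r ℤ.* a ℤ.+ b) ≡ r ℤ.* (p ℤ.* a) ℤ.+ p ℤ.* b
  expand = solve-∀
  regroup : ∀ r s x → r ℤ.* ℤ.- s ℤ.+ x ≡ x ℤ.- r ℤ.* s
  regroup = solve-∀

placeDistinct0-expansion : ∀ r v m → placeDistinct 0 r v m ≡ applyPoly (signedStirling1 r) (suc r) v m
placeDistinct0-expansion zero    v m = sym (trans (ℤₚ.+-identityˡ _) (ℤₚ.*-identityˡ (v m)))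
placeDistinct0-expansion (suc r) v m = begin
  placeDistinct 0 (suc r) v m
    ≡⟨ placeDistinct-suc 0 r v m ⟩
  place r (placeDistinct 0 r v) m
    ≡⟨ place-cong r (placeDistinct0-expansion r v) m ⟩
  place r (applyPoly (signedStirling1 r) (suc r) v) m
    ≡⟨ applyPoly-place r (signedStirling1 r) (suc r) v m (signedStirling1-vanish (ℕₚ.n<1+n r)) ⟩
  applyPoly (timesXminus r (signedStirling1 r)) (suc (suc r)) v m
    ≡⟨ sumℤ<-cong (suc (suc r)) (λ i _ → cong (ℤ._* placeFree i v m) (sym (signedStirling1-recurrence r i))) ⟩
  applyPoly (signedStirling1 (suc r)) (suc (suc r)) v m ∎
  where open ≡-Reasoning

convolve : (ℕ → ℤ) → (ℕ → ℤ) → ℕ → ℤ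
convolve c c′ J = sumℤ< (suc J) (λ i → c i ℤ.* c′ (J ∸ i))

applyPoly-convolve : ∀ N c c′ v m →
  sumℤ< N (λ i → c i ℤ.* applyPoly c′ (N ∸ i) (placeFree i v) m) ≡ applyPoly (convolve c c′) N v m
applyPoly-convolve N c c′ v m = begin
  sumℤ< N (λ i → c i ℤ.* applyPoly c′ (N ∸ i) (placeFree i v) m)
    ≡⟨ sumℤ<-cong N (λ i _ → distribute i) ⟩
  sumℤ< N (λ i → sumℤ< (N ∸ i) (h i))
    ≡⟨ sumℤ<-triangle N h ⟩
  sumℤ< N (λ J → sumℤ< (suc J) (λ i → h i (J ∸ i)))
    ≡⟨ sumℤ<-cong N (λ J _ → collect J) ⟩
  applyPoly (convolve c c′) N v m ∎
  where
  open ≡-Reasoning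
  h : ℕ → ℕ → ℤ
  h i j = c i ℤ.* (c′ j ℤ.* placeFree (j + i) v m)
  distribute : ∀ i → c i ℤ.* applyPoly c′ (N ∸ i) (placeFree i v) m ≡ sumℤ< (N ∸ i) (h i)
  distribute i =
    trans (*-distribˡ-sumℤ< (N ∸ i) (c i) (λ j → c′ j ℤ.* placeFree j (placeFree i v) m))
          (sumℤ<-cong (N ∸ i) (λ j _ → cong (λ w → c i ℤ.* (c′ j ℤ.* w m)) (placeFree-+ j i v)))
  collect : ∀ J → sumℤ< (suc J) (λ i → h i (J ∸ i)) ≡ convolve c c′ J ℤ.* placeFree J v m
  collect J = begin
    sumℤ< (suc J) (λ i → h i (J ∸ i))
      ≡⟨ sumℤ<-cong (suc J) (λ i i<1+J →
           trans (cong (λ k → c i ℤ.* (c′ (J ∸ i) ℤ.* placeFree k v m)) (ℕₚ.m∸n+n≡m (ℕₚ.≤-pred i<1+J)))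
                 (sym (ℤₚ.*-assoc (c i) (c′ (J ∸ i)) (placeFree J v m)))) ⟩
    sumℤ< (suc J) (λ i → c i ℤ.* c′ (J ∸ i) ℤ.* placeFree J v m)
      ≡⟨ sym (*-distribʳ-sumℤ< (suc J) (placeFree J v m) (λ i → c i ℤ.* c′ (J ∸ i))) ⟩
    convolve c c′ J ℤ.* placeFree J v m ∎

m+n<o⇒n<o∸k : ∀ {m n o k} → k ≤ m → m + n < o → n < o ∸ k
m+n<o⇒n<o∸k {m} {n} {o} {k} k≤m m+n<o = ℕₚ.m+n≤o⇒m≤o∸n (suc n) {k} (begin
  suc n + k  ≤⟨ s≤s (ℕₚ.+-monoʳ-≤ n k≤m) ⟩
  suc n + m  ≡⟨ cong suc (ℕₚ.+-comm n m) ⟩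
  suc m + n  ≤⟨ m+n<o ⟩
  o          ∎)
  where open ℕₚ.≤-Reasoning

convStirling1-vanish : ∀ rs {j} → sum rs < j → convStirling1 rs j ≡ 0
convStirling1-vanish []       {suc j} _ = refl
convStirling1-vanish (r ∷ rs) {j} r+s<j = ℤₚ.+-injective (begin
  + convStirling1 (r ∷ rs) j      ≡⟨ pos-sum-map-upTo (suc j) term ⟩
  sumℤ< (suc j) (λ i → + term i)  ≡⟨ sumℤ<-extend 0 (suc j) (λ i → + term i) z≤n (λ i _ _ → cong +_ (term≡0 i)) ⟩
  + 0                             ∎)
  where
  open ≡-Reasoning
  term : ℕ → ℕ
  term i = stirling1 r i * convStirling1 rs (j ∸ i)
  term≡0 : ∀ i → term i ≡ 0
  term≡0 i with r ℕₚ.<? i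
  ... | yes r<i = cong (_* convStirling1 rs (j ∸ i)) (stirling1-vanish r<i)
  ... | no  r≮i =
    trans (cong (stirling1 r i *_) (convStirling1-vanish rs s<j∸i)) (ℕₚ.*-zeroʳ (stirling1 r i))
    where
    s<j∸i : sum rs < j ∸ i
    s<j∸i = m+n<o⇒n<o∸k (ℕₚ.≮⇒≥ r≮i) r+s<j

aCoef-vanish : ∀ rs {j} → sum rs < j → aCoef rs j ≡ + 0
aCoef-vanish rs {j} s<j = j≡0⇒i*j≡0 ((ℤ.- + 1) ℤ.^ (sum rs ∸ j)) (cong +_ (convStirling1-vanish rs s<j))

m+n∸[o+p]≡m∸o+[n∸p] : ∀ {m n o p} → o ≤ m → p ≤ n → (m + n) ∸ (o + p) ≡ (m ∸ o) + (n ∸ p)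
m+n∸[o+p]≡m∸o+[n∸p] {m} {n} {o} {p} o≤m p≤n =
  trans (sym (ℕₚ.∸-+-assoc (m + n) o p))
        (trans (cong (_∸ p) (ℕₚ.+-∸-comm n o≤m)) (ℕₚ.+-∸-assoc (m ∸ o) p≤n))

aCoef-cons : ∀ r rs J → aCoef (r ∷ rs) J ≡ convolve (signedStirling1 r) (aCoef rs) J
aCoef-cons r rs J = begin
  σ ℤ.* + sum (map term (upTo (suc J)))       ≡⟨ cong (σ ℤ.*_) (pos-sum-map-upTo (suc J) term) ⟩
  σ ℤ.* sumℤ< (suc J) (λ i → + term i)        ≡⟨ *-distribˡ-sumℤ< (suc J) σ (λ i → + term i) ⟩
  sumℤ< (suc J) (λ i → σ ℤ.* + term i)        ≡⟨ sumℤ<-cong (suc J) (λ i i<1+J → split-sign i (ℕₚ.≤-pred i<1+J)) ⟩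
  convolve (signedStirling1 r) (aCoef rs) J   ∎
  where
  open ≡-Reasoning
  s = sum rs
  σ = (ℤ.- + 1) ℤ.^ ((r + s) ∸ J)
  term : ℕ → ℕ
  term i = stirling1 r i * convStirling1 rs (J ∸ i)
  split-sign : ∀ i → i ≤ J → σ ℤ.* + term i ≡ signedStirling1 r i ℤ.* aCoef rs (J ∸ i)
  split-sign i i≤J with r ℕₚ.<? i | s ℕₚ.<? (J ∸ i)
  ... | yes r<i | _ =
    trans (j≡0⇒i*j≡0 σ (cong (λ z → + (z * convStirling1 rs (J ∸ i))) (stirling1-vanish r<i)))
          (sym (i≡0⇒i*j≡0 (aCoef rs (J ∸ i)) (signedStirling1-vanish r<i)))
  ... | no _ | yes s<J∸i =
    trans (j≡0⇒i*j≡0 σ (cong +_ (trans (cong (stirling1 r i *_) (convStirling1-vanish rs s<J∸i))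
                                       (ℕₚ.*-zeroʳ (stirling1 r i)))))
          (sym (j≡0⇒i*j≡0 (signedStirling1 r i) (aCoef-vanish rs s<J∸i)))
  ... | no r≮i | no s≮J∸i = begin
    σ ℤ.* + term i
      ≡⟨ cong₂ ℤ._*_ (cong ((ℤ.- + 1) ℤ.^_) exponent) (ℤₚ.pos-* (stirling1 r i) (convStirling1 rs (J ∸ i))) ⟩
    (ℤ.- + 1) ℤ.^ ((r ∸ i) + (s ∸ (J ∸ i))) ℤ.* (S₁ ℤ.* S₂)
      ≡⟨ cong (ℤ._* (S₁ ℤ.* S₂)) (ℤₚ.^-distribˡ-+-* (ℤ.- + 1) (r ∸ i) (s ∸ (J ∸ i))) ⟩
    ((ℤ.- + 1) ℤ.^ (r ∸ i) ℤ.* (ℤ.- + 1) ℤ.^ (s ∸ (J ∸ i))) ℤ.* (S₁ ℤ.* S₂)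
      ≡⟨ *-interchange ((ℤ.- + 1) ℤ.^ (r ∸ i)) ((ℤ.- + 1) ℤ.^ (s ∸ (J ∸ i))) S₁ S₂ ⟩
    signedStirling1 r i ℤ.* aCoef rs (J ∸ i) ∎
    where
    S₁ S₂ : ℤ
    S₁ = + stirling1 r i
    S₂ = + convStirling1 rs (J ∸ i)
    exponent : (r + s) ∸ J ≡ (r ∸ i) + (s ∸ (J ∸ i))
    exponent = trans (cong ((r + s) ∸_) (sym (ℕₚ.m+[n∸m]≡n i≤J)))
                     (m+n∸[o+p]≡m∸o+[n∸p] (ℕₚ.≮⇒≥ r≮i) (ℕₚ.≮⇒≥ s≮J∸i))

placeSegments-expansion : ∀ rs N → sum rs < N → ∀ v m →
  placeSegments rs v m ≡ applyPoly (aCoef rs) N v m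
placeSegments-expansion [] N 0<N v m = sym (begin
  applyPoly (aCoef []) N v m  ≡⟨ sumℤ<-extend 1 N (λ j → aCoef [] j ℤ.* placeFree j v m) 0<N
                                   (λ j 0<j _ → i≡0⇒i*j≡0 (placeFree j v m) (aCoef-vanish [] 0<j)) ⟩
  + 0 ℤ.+ + 1 ℤ.* v m         ≡⟨ trans (ℤₚ.+-identityˡ _) (ℤₚ.*-identityˡ (v m)) ⟩
  v m                         ∎)
  where open ≡-Reasoning
placeSegments-expansion (r ∷ rs) N r+s<N v m = begin
  placeDistinct 0 r (placeSegments rs v) m
    ≡⟨ placeDistinct0-expansion r (placeSegments rs v) m ⟩
  applyPoly (signedStirling1 r) (suc r) (placeSegments rs v) m
    ≡⟨ sym (sumℤ<-extend (suc r) N (λ i → signedStirling1 r i ℤ.* placeFree i (placeSegments rs v) m) r<N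
              (λ i r<i _ → i≡0⇒i*j≡0 (placeFree i (placeSegments rs v) m) (signedStirling1-vanish r<i))) ⟩
  applyPoly (signedStirling1 r) N (placeSegments rs v) m
    ≡⟨ sumℤ<-cong N (λ i _ → expand-inner i) ⟩
  sumℤ< N (λ i → signedStirling1 r i ℤ.* applyPoly (aCoef rs) (N ∸ i) (placeFree i v) m)
    ≡⟨ applyPoly-convolve N (signedStirling1 r) (aCoef rs) v m ⟩
  applyPoly (convolve (signedStirling1 r) (aCoef rs)) N v m
    ≡⟨ sumℤ<-cong N (λ J _ → cong (ℤ._* placeFree J v m) (sym (aCoef-cons r rs J))) ⟩
  applyPoly (aCoef (r ∷ rs)) N v m ∎
  where
  open ≡-Reasoning
  r<N : r < N
  r<N = ℕₚ.<-≤-trans (s≤s (ℕₚ.m≤m+n r (sum rs))) r+s<N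
  expand-inner : ∀ i → signedStirling1 r i ℤ.* placeFree i (placeSegments rs v) m
                     ≡ signedStirling1 r i ℤ.* applyPoly (aCoef rs) (N ∸ i) (placeFree i v) m
  expand-inner i with r ℕₚ.<? i
  ... | yes r<i = trans (i≡0⇒i*j≡0 _ (signedStirling1-vanish r<i))
                        (sym (i≡0⇒i*j≡0 _ (signedStirling1-vanish r<i)))
  ... | no  r≮i = cong (signedStirling1 r i ℤ.*_)
                    (trans (placeFree-placeSegments i rs v m)
                           (placeSegments-expansion rs (N ∸ i) s<N∸i (placeFree i v) m))
    where
    s<N∸i : sum rs < N ∸ i
    s<N∸i = m+n<o⇒n<o∸k (ℕₚ.≮⇒≥ r≮i) r+s<N

-- Counting restricted growth strings

≡ᵇ-reflects-≡ : ∀ m n → Reflects (m ≡ n) (m ≡ᵇ n)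
≡ᵇ-reflects-≡ m n = fromEquivalence (ℕₚ.≡ᵇ⇒≡ m n) (ℕₚ.≡⇒≡ᵇ m n)

≡ᵇ-refl : ∀ m → (m ≡ᵇ m) ≡ true
≡ᵇ-refl zero    = refl
≡ᵇ-refl (suc m) = ≡ᵇ-refl m

≢⇒≡ᵇ≡false : ∀ {m n} → m ≢ n → (m ≡ᵇ n) ≡ false
≢⇒≡ᵇ≡false {m} {n} m≢n with m ≡ᵇ n | ≡ᵇ-reflects-≡ m n
... | true  | ofʸ m≡n = ⊥-elim (m≢n m≡n)
... | false | _       = refl

≡ᵇ-sym : ∀ m n → (m ≡ᵇ n) ≡ (n ≡ᵇ m)
≡ᵇ-sym zero    zero    = refl
≡ᵇ-sym zero    (suc n) = refl
≡ᵇ-sym (suc m) zero    = refl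
≡ᵇ-sym (suc m) (suc n) = ≡ᵇ-sym m n

if-≤ᵇ : ∀ {A : Set} {x m} → x ≤ m → (a b : A) → (if x ≤ᵇ m then a else b) ≡ a
if-≤ᵇ {x = x} {m} x≤m a b with x ≤ᵇ m | ℕₚ.≤ᵇ-reflects-≤ x m
... | true  | _        = refl
... | false | ofⁿ x≰m = ⊥-elim (x≰m x≤m)

if-≰ᵇ : ∀ {A : Set} {x m} → m < x → (a b : A) → (if x ≤ᵇ m then a else b) ≡ b
if-≰ᵇ {x = x} {m} m<x a b with x ≤ᵇ m | ℕₚ.≤ᵇ-reflects-≤ x m
... | true  | ofʸ x≤m = ⊥-elim (ℕₚ.<⇒≱ m<x x≤m)
... | false | _       = refl

any-++ : ∀ {A : Set} (p : A → Bool) xs ys → any p (xs ++ ys) ≡ any p xs ∨ any p ys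
any-++ p []       ys = refl
any-++ p (x ∷ xs) ys = trans (cong (p x ∨_) (any-++ p xs ys)) (sym (Boolₚ.∨-assoc (p x) _ _))

allDistinct-head : ∀ s S → allDistinct (s ∷ S) ≡ true → any (s ≡ᵇ_) S ≡ false
allDistinct-head s S dsS = trans (sym (Boolₚ.not-involutive _)) (cong not (Boolₚ.∧-conicalˡ _ _ dsS))

allDistinct-∷ʳ : ∀ S x → any (x ≡ᵇ_) S ≡ false → allDistinct S ≡ true → allDistinct (S ∷ʳ x) ≡ true
allDistinct-∷ʳ []      x _   _  = refl
allDistinct-∷ʳ (s ∷ S) x x∉S dS = begin
  not (any (s ≡ᵇ_) (S ∷ʳ x)) ∧ allDistinct (S ∷ʳ x)
    ≡⟨ cong₂ (λ a b → not a ∧ b) (any-++ (s ≡ᵇ_) S (x ∷ []))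
             (allDistinct-∷ʳ S x (Boolₚ.∨-conicalʳ _ _ x∉S) (Boolₚ.∧-conicalʳ _ _ dS)) ⟩
  not (any (s ≡ᵇ_) S ∨ ((s ≡ᵇ x) ∨ false)) ∧ true
    ≡⟨ cong₂ (λ a b → not (a ∨ (b ∨ false)) ∧ true) (allDistinct-head s S dS)
             (trans (≡ᵇ-sym s x) (Boolₚ.∨-conicalˡ _ _ x∉S)) ⟩
  true ∎
  where open ≡-Reasoning

allDistinct-++-[] : ∀ S → allDistinct S ≡ true → allDistinct (S ++ []) ≡ true
allDistinct-++-[] S dS = trans (cong allDistinct (Listₚ.++-identityʳ S)) dS

allDistinct-repeat : ∀ S x t → any (x ≡ᵇ_) S ≡ true → allDistinct (S ++ x ∷ t) ≡ false
allDistinct-repeat (s ∷ S) x t x∈sS with x ≡ᵇ s | ≡ᵇ-reflects-≡ x s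
... | true  | ofʸ refl = cong (λ b → not b ∧ allDistinct (S ++ x ∷ t)) x∈S++x∷t
  where
  x∈S++x∷t : any (x ≡ᵇ_) (S ++ x ∷ t) ≡ true
  x∈S++x∷t = trans (any-++ (x ≡ᵇ_) S (x ∷ t))
                   (trans (cong (λ b → any (x ≡ᵇ_) S ∨ (b ∨ any (x ≡ᵇ_) t)) (≡ᵇ-refl x)) (Boolₚ.∨-zeroʳ _))
... | false | _        = trans (cong (not (any (s ≡ᵇ_) (S ++ x ∷ t)) ∧_) (allDistinct-repeat S x t x∈sS))
                               (Boolₚ.∧-zeroʳ _)

LabelSet : ℕ → List ℕ → Set
LabelSet m S = All (_< m) S × allDistinct S ≡ true

fresh-label : ∀ {m} S → All (_< m) S → any (m ≡ᵇ_) S ≡ false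
fresh-label []      []           = refl
fresh-label (s ∷ S) (s<m ∷ S<m) =
  cong₂ _∨_ (≢⇒≡ᵇ≡false (λ m≡s → ℕₚ.<⇒≢ s<m (sym m≡s))) (fresh-label S S<m)

sumℤ<-avoiding : ∀ m S a → LabelSet m S →
  sumℤ< m (λ x → if any (x ≡ᵇ_) S then + 0 else a) ≡ (+ m ℤ.- + length S) ℤ.* a
sumℤ<-avoiding m []      a _ =
  trans (sumℤ<-const m a) (cong (ℤ._* a) (sym (cong +_ (ℕₚ.+-identityʳ m))))
sumℤ<-avoiding m (s ∷ S) a (s<m ∷ S<m , dsS) = begin
  X                                         ≡⟨ add-sub X a ⟩
  (X ℤ.+ a) ℤ.- a                           ≡⟨ cong (ℤ._- a) remove-s ⟩
  (+ m ℤ.- + length S) ℤ.* a ℤ.- a          ≡⟨ one-more (+ m) (+ length S) a ⟩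
  (+ m ℤ.- (+ 1 ℤ.+ + length S)) ℤ.* a      ≡⟨ cong (λ l → (+ m ℤ.- l) ℤ.* a) (sym (ℤₚ.pos-+ 1 (length S))) ⟩
  (+ m ℤ.- + length (s ∷ S)) ℤ.* a          ∎
  where
  open ≡-Reasoning
  avoid : List ℕ → ℕ → ℤ
  avoid T x = if any (x ≡ᵇ_) T then + 0 else a
  X = sumℤ< m (avoid (s ∷ S))
  split : ∀ x → (if (x ≡ᵇ s) ∨ any (x ≡ᵇ_) S then + 0 else a) ℤ.+ (if x ≡ᵇ s then a else + 0) ≡ avoid S x
  split x with x ≡ᵇ s | ≡ᵇ-reflects-≡ x s
  ... | true  | ofʸ refl = trans (ℤₚ.+-identityˡ a) (sym (cong (λ b → if b then + 0 else a) (allDistinct-head s S dsS)))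
  ... | false | _        = ℤₚ.+-identityʳ (avoid S x)
  remove-s : X ℤ.+ a ≡ (+ m ℤ.- + length S) ℤ.* a
  remove-s = begin
    X ℤ.+ a
      ≡⟨ cong (ℤ._+_ X) (sym δₛ) ⟩
    X ℤ.+ sumℤ< m (λ x → if x ≡ᵇ s then a else + 0)
      ≡⟨ sym (sumℤ<-distrib-+ m (avoid (s ∷ S)) (λ x → if x ≡ᵇ s then a else + 0)) ⟩
    sumℤ< m (λ x → avoid (s ∷ S) x ℤ.+ (if x ≡ᵇ s then a else + 0))
      ≡⟨ sumℤ<-cong m (λ x _ → split x) ⟩
    sumℤ< m (avoid S)
      ≡⟨ sumℤ<-avoiding m S a (S<m , Boolₚ.∧-conicalʳ _ _ dsS) ⟩
    (+ m ℤ.- + length S) ℤ.* a ∎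
    where
    δₛ : sumℤ< m (λ x → if x ≡ᵇ s then a else + 0) ≡ a
    δₛ = trans (sumℤ<-point (λ x → if x ≡ᵇ s then a else + 0) s<m
                 (λ x x≢s → cong (λ b → if b then a else + 0) (≢⇒≡ᵇ≡false x≢s)))
               (cong (λ b → if b then a else + 0) (≡ᵇ-refl s))
  add-sub : ∀ x a → x ≡ (x ℤ.+ a) ℤ.- a
  add-sub = solve-∀
  one-more : ∀ m l a → (m ℤ.- l) ℤ.* a ℤ.- a ≡ (m ℤ.- (+ 1 ℤ.+ l)) ℤ.* a
  one-more = solve-∀

labelsAfter : ℕ → ℕ → ℕ
labelsAfter m x = if x ≡ᵇ m then suc m else m

labelsAfter-old : ∀ {m x} → x < m → labelsAfter m x ≡ m
labelsAfter-old {m} x<m = cong (λ b → if b then suc m else m) (≢⇒≡ᵇ≡false (ℕₚ.<⇒≢ x<m))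

labelsAfter-new : ∀ m → labelsAfter m m ≡ suc m
labelsAfter-new m = cong (λ b → if b then suc m else m) (≡ᵇ-refl m)

sumℤ<-≤ᵇ : ∀ K m (f : ℕ → ℤ) → m ≤ K → (K ≡ m → f m ≡ + 0) →
  sumℤ< K (λ x → if x ≤ᵇ m then f x else + 0) ≡ sumℤ< (suc m) f
sumℤ<-≤ᵇ K m f m≤K fm≡0 with ℕₚ.m≤n⇒m<n∨m≡n m≤K
... | inj₁ m<K = begin
  sumℤ< K (λ x → if x ≤ᵇ m then f x else + 0)
    ≡⟨ sumℤ<-extend (suc m) K _ m<K (λ x m<x _ → if-≰ᵇ m<x (f x) (+ 0)) ⟩
  sumℤ< (suc m) (λ x → if x ≤ᵇ m then f x else + 0)
    ≡⟨ sumℤ<-cong (suc m) (λ x x<1+m → if-≤ᵇ (ℕₚ.≤-pred x<1+m) (f x) (+ 0)) ⟩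
  sumℤ< (suc m) f ∎
  where open ≡-Reasoning
... | inj₂ refl = begin
  sumℤ< m (λ x → if x ≤ᵇ m then f x else + 0)
    ≡⟨ sumℤ<-cong m (λ x x<m → if-≤ᵇ (ℕₚ.<⇒≤ x<m) (f x) (+ 0)) ⟩
  sumℤ< m f
    ≡⟨ sym (trans (cong (ℤ._+_ (sumℤ< m f)) (fm≡0 refl)) (ℤₚ.+-identityʳ (sumℤ< m f))) ⟩
  sumℤ< (suc m) f ∎
  where open ≡-Reasoning

first-letter-sum≡place : ∀ K m S (c : ℕ → ℤ) (Y : Seq) → m ≤ K → LabelSet m S → Y (suc K) ≡ + 0 →
  (∀ x → x < K → x ≤ m → c x ≡ (if any (x ≡ᵇ_) S then + 0 else Y (labelsAfter m x))) →
  sumℤ< K (λ x → if x ≤ᵇ m then c x else + 0) ≡ place (length S) Y m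
first-letter-sum≡place K m S c Y m≤K (S<m , dS) Y[1+K]≡0 c≡H = begin
  sumℤ< K (λ x → if x ≤ᵇ m then c x else + 0)
    ≡⟨ sumℤ<-cong K (λ x x<K → only-below x x<K) ⟩
  sumℤ< K (λ x → if x ≤ᵇ m then H x else + 0)
    ≡⟨ sumℤ<-≤ᵇ K m H m≤K H-new ⟩
  sumℤ< m H ℤ.+ H m
    ≡⟨ cong₂ ℤ._+_ (trans (sumℤ<-cong m (λ x x<m → H-old x x<m)) (sumℤ<-avoiding m S (Y m) (S<m , dS)))
                   H-m ⟩
  (+ m ℤ.- + length S) ℤ.* Y m ℤ.+ Y (suc m) ∎
  where
  open ≡-Reasoning
  H : ℕ → ℤ
  H x = if any (x ≡ᵇ_) S then + 0 else Y (labelsAfter m x)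
  only-below : ∀ x → x < K → (if x ≤ᵇ m then c x else + 0) ≡ (if x ≤ᵇ m then H x else + 0)
  only-below x x<K with x ≤ᵇ m | ℕₚ.≤ᵇ-reflects-≤ x m
  ... | true  | ofʸ x≤m = c≡H x x<K x≤m
  ... | false | _       = refl
  H-old : ∀ x → x < m → H x ≡ (if any (x ≡ᵇ_) S then + 0 else Y m)
  H-old x x<m = cong (λ l → if any (x ≡ᵇ_) S then + 0 else Y l) (labelsAfter-old x<m)
  H-m : H m ≡ Y (suc m)
  H-m = trans (cong (λ b → if b then + 0 else Y (labelsAfter m m)) (fresh-label S S<m))
              (cong Y (labelsAfter-new m))
  H-new : K ≡ m → H m ≡ + 0
  H-new K≡m = trans H-m (trans (cong (λ l → Y (suc l)) (sym K≡m)) Y[1+K]≡0)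

countTrue-cong : ∀ {A : Set} {P Q : A → Bool} xs → (∀ x → P x ≡ Q x) → countTrue P xs ≡ countTrue Q xs
countTrue-cong []       P≡Q = refl
countTrue-cong (x ∷ xs) P≡Q = cong₂ (λ b n → (if b then 1 else 0) + n) (P≡Q x) (countTrue-cong xs P≡Q)

countTrue-none : ∀ {A : Set} {P : A → Bool} xs → (∀ x → P x ≡ false) → countTrue P xs ≡ 0
countTrue-none []       P≡false = refl
countTrue-none (x ∷ xs) P≡false = cong₂ (λ b n → (if b then 1 else 0) + n) (P≡false x) (countTrue-none xs P≡false)

countTrue-∧ : ∀ {A : Set} b (P : A → Bool) xs → countTrue (λ x → b ∧ P x) xs ≡ (if b then countTrue P xs else 0)
countTrue-∧ true  P xs = refl
countTrue-∧ false P xs = countTrue-none xs (λ _ → refl)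

countTrue-++ : ∀ {A : Set} (P : A → Bool) xs ys → countTrue P (xs ++ ys) ≡ countTrue P xs + countTrue P ys
countTrue-++ P []       ys = refl
countTrue-++ P (x ∷ xs) ys =
  trans (cong (_+_ (if P x then 1 else 0)) (countTrue-++ P xs ys))
        (sym (ℕₚ.+-assoc (if P x then 1 else 0) (countTrue P xs) (countTrue P ys)))

countTrue-map : ∀ {A B : Set} (P : B → Bool) (h : A → B) xs →
  countTrue P (map h xs) ≡ sum (map (λ x → if P (h x) then 1 else 0) xs)
countTrue-map P h []       = refl
countTrue-map P h (x ∷ xs) = cong (_+_ (if P (h x) then 1 else 0)) (countTrue-map P h xs)

countTrue-words-suc : ∀ (P : List ℕ → Bool) N K →
  + countTrue P (words (suc N) K) ≡ sumℤ< K (λ x → + countTrue (λ w → P (x ∷ w)) (words N K))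
countTrue-words-suc P N K = prepend (words N K)
  where
  extensions : List (List ℕ) → List (List ℕ)
  extensions ws = concatMap (λ w → map (λ x → x ∷ w) (upTo K)) ws
  count₁ : List ℕ → ℕ → ℕ
  count₁ w x = if P (x ∷ w) then 1 else 0
  prepend : ∀ ws → + countTrue P (extensions ws) ≡ sumℤ< K (λ x → + countTrue (λ w → P (x ∷ w)) ws)
  prepend []       = sym (sumℤ<-extend 0 K (λ _ → + 0) z≤n (λ _ _ _ → refl))
  prepend (w ∷ ws) = begin
    + countTrue P (map (λ x → x ∷ w) (upTo K) ++ extensions ws)
      ≡⟨ cong +_ (countTrue-++ P (map (λ x → x ∷ w) (upTo K)) (extensions ws)) ⟩
    + (countTrue P (map (λ x → x ∷ w) (upTo K)) + countTrue P (extensions ws))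
      ≡⟨ ℤₚ.pos-+ (countTrue P (map (λ x → x ∷ w) (upTo K))) (countTrue P (extensions ws)) ⟩
    + countTrue P (map (λ x → x ∷ w) (upTo K)) ℤ.+ + countTrue P (extensions ws)
      ≡⟨ cong₂ ℤ._+_ (trans (cong +_ (countTrue-map P (λ x → x ∷ w) (upTo K))) (pos-sum-map-upTo K (count₁ w)))
                     (prepend ws) ⟩
    sumℤ< K (λ x → + count₁ w x) ℤ.+ sumℤ< K (λ x → + countTrue (λ w → P (x ∷ w)) ws)
      ≡⟨ sym (sumℤ<-distrib-+ K (λ x → + count₁ w x) (λ x → + countTrue (λ w → P (x ∷ w)) ws)) ⟩
    sumℤ< K (λ x → + count₁ w x ℤ.+ + countTrue (λ w → P (x ∷ w)) ws)
      ≡⟨ sumℤ<-cong K (λ x _ → sym (ℤₚ.pos-+ (count₁ w x) (countTrue (λ w → P (x ∷ w)) ws))) ⟩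
    sumℤ< K (λ x → + countTrue (λ w′ → P (x ∷ w′)) (w ∷ ws)) ∎
    where open ≡-Reasoning

δ : ℕ → Seq
δ K m = if m ≡ᵇ K then + 1 else + 0

VanishesAbove : ℕ → Seq → Set
VanishesAbove K v = ∀ m → K < m → v m ≡ + 0

δ-vanishesAbove : ∀ K → VanishesAbove K (δ K)
δ-vanishesAbove K m K<m = cong (λ b → if b then + 1 else + 0) (≢⇒≡ᵇ≡false (λ m≡K → ℕₚ.<⇒≢ K<m (sym m≡K)))

place-vanishesAbove : ∀ {K} t {v} → VanishesAbove K v → VanishesAbove K (place t v)
place-vanishesAbove t {v} v≡0 m K<m =
  trans (cong₂ (λ a b → (+ m ℤ.- + t) ℤ.* a ℤ.+ b) (v≡0 m K<m) (v≡0 (suc m) (ℕₚ.m<n⇒m<1+n K<m)))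
        (trans (ℤₚ.+-identityʳ _) (ℤₚ.*-zeroʳ (+ m ℤ.- + t)))

placeDistinct-vanishesAbove : ∀ {K} t r {v} → VanishesAbove K v → VanishesAbove K (placeDistinct t r v)
placeDistinct-vanishesAbove t zero    v≡0 = v≡0
placeDistinct-vanishesAbove t (suc r) v≡0 = place-vanishesAbove t (placeDistinct-vanishesAbove (suc t) r v≡0)

placeSegments-vanishesAbove : ∀ {K} rs {v} → VanishesAbove K v → VanishesAbove K (placeSegments rs v)
placeSegments-vanishesAbove []       v≡0 = v≡0
placeSegments-vanishesAbove (r ∷ rs) v≡0 = placeDistinct-vanishesAbove 0 r (placeSegments-vanishesAbove rs v≡0)

-- Completion K m S r rs w: the word w completes a prefix that has opened the blocks 0, …, m − 1 and
-- stops inside a distinguished set whose elements so far lie in the blocks S, with r elements of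
-- that set still to come, followed by distinguished sets of sizes rs; K blocks are used in the end.
Completion : ℕ → ℕ → List ℕ → ℕ → List ℕ → List ℕ → Bool
Completion K m S r rs w = isRGS m K w ∧ (allDistinct (S ++ take r w) ∧ distinctOn rs (drop r w))

Completion-∷ : ∀ K m S r rs x w →
  Completion K m S (suc r) rs (x ∷ w) ≡ (x ≤ᵇ m) ∧ Completion K (labelsAfter m x) (S ∷ʳ x) r rs w
Completion-∷ K m S r rs x w =
  trans (Boolₚ.∧-assoc (x ≤ᵇ m) _ _)
        (cong (λ ys → (x ≤ᵇ m) ∧ (isRGS (labelsAfter m x) K w ∧ (allDistinct ys ∧ distinctOn rs (drop r w))))
              (sym (Listₚ.++-assoc S (x ∷ []) (take r w))))

extend-LabelSet : ∀ {K m S x} → x < K → x ≤ m → m ≤ K → LabelSet m S → any (x ≡ᵇ_) S ≡ false →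
  labelsAfter m x ≤ K × LabelSet (labelsAfter m x) (S ∷ʳ x)
extend-LabelSet {S = S} {x} x<K x≤m m≤K (S<m , dS) x∉S with ℕₚ.m≤n⇒m<n∨m≡n x≤m
... | inj₁ x<m rewrite labelsAfter-old x<m =
  m≤K , ∷ʳ⁺ S<m x<m , allDistinct-∷ʳ S x x∉S dS
... | inj₂ refl rewrite labelsAfter-new x =
  x<K , ∷ʳ⁺ (All.map ℕₚ.m<n⇒m<1+n S<m) (ℕₚ.n<1+n x) , allDistinct-∷ʳ S x x∉S dS

countTrue-Completion : ∀ K m S r rs → m ≤ K → LabelSet m S →
  + countTrue (Completion K m S r rs) (words (r + sum rs) K)
  ≡ placeDistinct (length S) r (placeSegments rs (δ K)) m
countTrue-Completion K m S zero [] m≤K (_ , dS) =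
  trans (cong (λ b → + ((if (m ≡ᵇ K) ∧ (b ∧ true) then 1 else 0) + 0)) (allDistinct-++-[] S dS))
        (indicator (m ≡ᵇ K))
  where
  indicator : ∀ b → + ((if b ∧ (true ∧ true) then 1 else 0) + 0) ≡ (if b then + 1 else + 0)
  indicator true  = refl
  indicator false = refl
countTrue-Completion K m S zero (r ∷ rs) m≤K (_ , dS) =
  trans (cong +_ (countTrue-cong (words (r + sum rs) K)
          (λ w → cong (λ b → isRGS m K w ∧ (b ∧ (allDistinct (take r w) ∧ distinctOn rs (drop r w))))
                      (allDistinct-++-[] S dS))))
        (countTrue-Completion K m [] r rs m≤K ([] , refl))
countTrue-Completion K m S (suc r) rs m≤K (S<m , dS) = begin
  + countTrue (Completion K m S (suc r) rs) (words (suc N) K)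
    ≡⟨ countTrue-words-suc (Completion K m S (suc r) rs) N K ⟩
  sumℤ< K (λ x → + countTrue (λ w → Completion K m S (suc r) rs (x ∷ w)) (words N K))
    ≡⟨ sumℤ<-cong K (λ x _ → choose-first x) ⟩
  sumℤ< K (λ x → if x ≤ᵇ m then c x else + 0)
    ≡⟨ first-letter-sum≡place K m S c Y m≤K (S<m , dS) Y[1+K]≡0 c≡ ⟩
  place (length S) Y m ∎
  where
  open ≡-Reasoning
  N = r + sum rs
  Y : Seq
  Y = placeDistinct (suc (length S)) r (placeSegments rs (δ K))
  Y[1+K]≡0 : Y (suc K) ≡ + 0
  Y[1+K]≡0 = placeDistinct-vanishesAbove (suc (length S)) r
               (placeSegments-vanishesAbove rs (δ-vanishesAbove K)) (suc K) (ℕₚ.n<1+n K)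
  c : ℕ → ℤ
  c x = + countTrue (Completion K (labelsAfter m x) (S ∷ʳ x) r rs) (words N K)
  choose-first : ∀ x → + countTrue (λ w → Completion K m S (suc r) rs (x ∷ w)) (words N K)
                       ≡ (if x ≤ᵇ m then c x else + 0)
  choose-first x =
    trans (cong +_ (trans (countTrue-cong (words N K) (Completion-∷ K m S r rs x))
                          (countTrue-∧ (x ≤ᵇ m) (Completion K (labelsAfter m x) (S ∷ʳ x) r rs) (words N K))))
          (pos-if (x ≤ᵇ m))
    where
    pos-if : ∀ b {n} → + (if b then n else 0) ≡ (if b then + n else + 0)
    pos-if true  = refl
    pos-if false = refl
  c≡ : ∀ x → x < K → x ≤ m → c x ≡ (if any (x ≡ᵇ_) S then + 0 else Y (labelsAfter m x))
  c≡ x x<K x≤m with any (x ≡ᵇ_) S in x∈S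
  ... | true  = cong +_ (countTrue-none (words N K) repeated)
    where
    repeated : ∀ w → Completion K (labelsAfter m x) (S ∷ʳ x) r rs w ≡ false
    repeated w =
      trans (cong (λ ys → isRGS (labelsAfter m x) K w ∧ (allDistinct ys ∧ distinctOn rs (drop r w)))
                  (Listₚ.++-assoc S (x ∷ []) (take r w)))
            (trans (cong (λ b → isRGS (labelsAfter m x) K w ∧ (b ∧ distinctOn rs (drop r w)))
                         (allDistinct-repeat S x (take r w) x∈S))
                   (Boolₚ.∧-zeroʳ _))
  ... | false with extend-LabelSet x<K x≤m m≤K (S<m , dS) x∈S
  ...   | m′≤K , state =
    trans (countTrue-Completion K (labelsAfter m x) (S ∷ʳ x) r rs m′≤K state)
          (cong (λ l → placeDistinct l r (placeSegments rs (δ K)) (labelsAfter m x)) length-∷ʳ)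
    where
    length-∷ʳ : length (S ∷ʳ x) ≡ suc (length S)
    length-∷ʳ = trans (Listₚ.length-++ S) (ℕₚ.+-comm (length S) 1)

-- An unconstrained element is a distinguished set of size 1.
distinctOn-singletons : ∀ n w → distinctOn (replicate n 1) w ≡ true
distinctOn-singletons zero    w       = refl
distinctOn-singletons (suc n) []      = distinctOn-singletons n []
distinctOn-singletons (suc n) (x ∷ w) = distinctOn-singletons n w

distinctOn-++-singletons : ∀ L n w → distinctOn (L ++ replicate n 1) w ≡ distinctOn L w
distinctOn-++-singletons []      n w = distinctOn-singletons n w
distinctOn-++-singletons (r ∷ L) n w =
  cong (allDistinct (take r w) ∧_) (distinctOn-++-singletons L n (drop r w))

placeSegments-singletons : ∀ n v → placeSegments (replicate n 1) v ≡ placeFree n v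
placeSegments-singletons zero    v = refl
placeSegments-singletons (suc n) v = cong (place 0) (placeSegments-singletons n v)

sum-++-singletons : ∀ L n → sum (L ++ replicate n 1) ≡ sum L + n
sum-++-singletons L n = trans (sum-++ L (replicate n 1)) (cong (_+_ (sum L)) (ones n))
  where
  ones : ∀ n → sum (replicate n 1) ≡ n
  ones zero    = refl
  ones (suc n) = cong suc (ones n)

RStirling2≡placeSegments : ∀ L n K → + RStirling2 (sum L + n) K L ≡ placeSegments L (placeFree n (δ K)) 0
RStirling2≡placeSegments L n K = begin
  + countTrue (λ w → isRGS 0 K w ∧ distinctOn L w) (words (sum L + n) K)
    ≡⟨ cong (λ N → + countTrue (λ w → isRGS 0 K w ∧ distinctOn L w) (words N K)) (sym (sum-++-singletons L n)) ⟩
  + countTrue (λ w → isRGS 0 K w ∧ distinctOn L w) (words (sum L′) K)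
    ≡⟨ cong +_ (countTrue-cong (words (sum L′) K)
                 (λ w → cong (isRGS 0 K w ∧_) (sym (distinctOn-++-singletons L n w)))) ⟩
  + countTrue (Completion K 0 [] 0 L′) (words (sum L′) K)
    ≡⟨ countTrue-Completion K 0 [] 0 L′ z≤n ([] , refl) ⟩
  placeSegments L′ (δ K) 0
    ≡⟨ cong (λ f → f 0) (placeSegments-++ L (replicate n 1) (δ K)) ⟩
  placeSegments L (placeSegments (replicate n 1) (δ K)) 0
    ≡⟨ cong (λ v → placeSegments L v 0) (placeSegments-singletons n (δ K)) ⟩
  placeSegments L (placeFree n (δ K)) 0 ∎
  where
  open ≡-Reasoning
  L′ = L ++ replicate n 1

rStirling2≡placeFree : ∀ r n j K →
  + rStirling2 (n + j + r) K r ≡ placeFree j (placeDistinct 0 r (placeFree n (δ K))) 0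
rStirling2≡placeFree r n j K = begin
  + rStirling2 (n + j + r) K r                         ≡⟨ cong (λ N → + rStirling2 N K r) (reorder r j n) ⟩
  + RStirling2 (sum (r ∷ []) + (j + n)) K (r ∷ [])     ≡⟨ RStirling2≡placeSegments (r ∷ []) (j + n) K ⟩
  placeDistinct 0 r (placeFree (j + n) (δ K)) 0        ≡⟨ cong (λ v → placeDistinct 0 r v 0) (sym (placeFree-+ j n (δ K))) ⟩
  placeDistinct 0 r (placeFree j (placeFree n (δ K))) 0 ≡⟨ sym (placeFree-placeDistinct j 0 r (placeFree n (δ K)) 0) ⟩
  placeFree j (placeDistinct 0 r (placeFree n (δ K))) 0 ∎
  where
  open ≡-Reasoning
  reorder : ∀ r j n → n + j + r ≡ r + 0 + (j + n)
  reorder = ℕ-Solver.solve-∀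

-- rs = (r₁, …, r_{p−1}) and rp = r_p.
corollary3 : (rs : List ℕ) (rp : ℕ) → Linked _≤_ (rs ++ rp ∷ []) →
    (n k : ℕ) → k ≤ n + sum rs →
    + RStirling2 (n + sum (rs ++ rp ∷ [])) (k + rp) (rs ++ rp ∷ [])
      ≡ sumℤ (sum rs)
          (λ j → (+ rStirling2 (n + j + rp) (k + rp) rp) ℤ.* aCoef rs j)
corollary3 rs rp _ n k _ = begin
  + RStirling2 (n + sum L) K L
    ≡⟨ cong (λ N → + RStirling2 N K L) (ℕₚ.+-comm n (sum L)) ⟩
  + RStirling2 (sum L + n) K L
    ≡⟨ RStirling2≡placeSegments L n K ⟩
  placeSegments L (placeFree n (δ K)) 0
    ≡⟨ cong (λ f → f 0) (placeSegments-++ rs (rp ∷ []) (placeFree n (δ K))) ⟩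
  placeSegments rs v 0
    ≡⟨ placeSegments-expansion rs (suc (sum rs)) (ℕₚ.n<1+n (sum rs)) v 0 ⟩
  sumℤ< (suc (sum rs)) (λ j → aCoef rs j ℤ.* placeFree j v 0)
    ≡⟨ sumℤ<-cong (suc (sum rs)) (λ j _ →
         trans (ℤₚ.*-comm (aCoef rs j) (placeFree j v 0)) (cong (ℤ._* aCoef rs j) (sym (rStirling2≡placeFree rp n j K)))) ⟩
  sumℤ< (suc (sum rs)) (λ j → + rStirling2 (n + j + rp) K rp ℤ.* aCoef rs j)
    ≡⟨ sym (sumℤ≡sumℤ< (sum rs) _) ⟩
  sumℤ (sum rs) (λ j → + rStirling2 (n + j + rp) K rp ℤ.* aCoef rs j) ∎
  where
  open ≡-Reasoning
  L = rs ++ rp ∷ []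
  K = k + rp
  v = placeDistinct 0 rp (placeFree n (δ K))
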